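{- Let $G\neq1$ be a finite abelian group and $a,b\in G$ with $R=\{a\}$, $L=\{b\}$ satisfying $R=R^{ -1}$, $L=L^{ -1}$, $1\notin R\cup L$, and let $\Gamma=\mathrm{SC}(G;R,L,\{1\})$ be connected with $A=\mathrm{Aut}(\Gamma)$. Then $\Gamma$ is transitive and non-normal, and one of the following holds: (1) $G\cong\mathbb Z_2$ and $A\cong D_8$; (2) $G\cong\mathbb Z_2\times\mathbb Z_2$ and $A\cong D_{16}$.
   Context: $\mathrm{SC}(G;R,L,\{1\})$ is the graph with vertex set $G\times\{1,2\}$ and edges $\{(x,1),(y,1)\}$ for $yx^{ -1}\in R$, $\{(x,2),(y,2)\}$ for $yx^{ -1}\in L$, and $\{(x,1),(x,2)\}$ for $x\in G$. $R_G=\{\rho_g\mid g\in G\}$ where $(x,i)^{\rho_g}=(xg,i)$; $\Gamma$ is normal if $R_G\trianglelefteq\mathrm{Aut}(\Gamma)$. Transitive means vertex-transitive. $D_{2m}$ is the dihedral group of order $2m$. -}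

module Defs where

open import Data.Nat using (ℕ; suc; _+_; _∸_; NonZero)
open import Data.Nat.DivMod using (_mod_)
open import Data.Fin using (Fin; toℕ)
open import Data.Bool using (Bool; true; false; not; _xor_)
open import Data.Product using (Σ; _×_; _,_; ∃)
open import Function using (_∘_)
open import Function.Bundles using (_↔_; Inverse)
open import Relation.Binary.PropositionalEquality using (_≡_)

IsFinite : Set → Set
IsFinite A = Σ ℕ λ n → A ↔ Fin n

-- Dihedral group D_{2m} of order 2m: element (i , s) stands for r^i s^s.
-- r^i s r^j s^t = r^(i-j) s^(1+t).
Dih : (m : ℕ) → Set
Dih m = Fin m × Bool

dmul : (m : ℕ) .{{_ : NonZero m}} → Dih m → Dih m → Dih m
dmul m (i , false) (j , t) = ((toℕ i + toℕ j) mod m , t)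
dmul m (i , true)  (j , t) = ((toℕ i + (m ∸ toℕ j)) mod m , not t)

Z2 : Set
Z2 = Bool

z2add : Z2 → Z2 → Z2
z2add = _xor_

Z2×Z2 : Set
Z2×Z2 = Bool × Bool

z22add : Z2×Z2 → Z2×Z2 → Z2×Z2
z22add (x , y) (u , v) = (x xor u , y xor v)

record GroupIso (A : Set) (_≈A_ : A → A → Set) (_·A_ : A → A → A)
                (B : Set) (_·B_ : B → B → B) : Set where
  field
    φ        : A → B
    φ-cong   : ∀ {x y} → x ≈A y → φ x ≡ φ y
    φ-hom    : ∀ x y → φ (x ·A y) ≡ φ x ·B φ y
    φ-inj    : ∀ {x y} → φ x ≡ φ y → x ≈A y
    φ-surj   : ∀ z → ∃ λ x → φ x ≡ z

data Layer : Set where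
  one two : Layer

module SC (G : Set) (_∙_ : G → G → G) (ε : G) (_⁻¹ : G → G) (a b : G) where

  V : Set
  V = G × Layer

  data Adj : V → V → Set where
    adjR  : ∀ {x y} → (y ∙ (x ⁻¹)) ≡ a → Adj (x , one) (y , one)
    adjL  : ∀ {x y} → (y ∙ (x ⁻¹)) ≡ b → Adj (x , two) (y , two)
    adj12 : ∀ x → Adj (x , one) (x , two)
    adj21 : ∀ x → Adj (x , two) (x , one)

  data Walk : V → V → Set where
    nil  : ∀ {u} → Walk u u
    cons : ∀ {u v w} → Adj u v → Walk v w → Walk u w

  Connected : Set
  Connected = ∀ u v → Walk u v

  record Aut : Set where
    field
      perm     : V ↔ V
      preserve : ∀ u v → Adj u v → Adj (Inverse.to perm u) (Inverse.to perm v)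
      reflect  : ∀ u v → Adj (Inverse.to perm u) (Inverse.to perm v) → Adj u v
  open Aut public

  app : Aut → V → V
  app σ = Inverse.to (perm σ)

  _≈A_ : Aut → Aut → Set
  σ ≈A τ = ∀ v → app σ v ≡ app τ v

  -- product in Aut(Γ) for right actions: v^(στ) = (v^σ)^τ
  _∘A_ : Aut → Aut → Aut
  σ ∘A τ = record
    { perm = Function.Construct.Composition.inverse (perm σ) (perm τ)
    ; preserve = λ u v e → preserve τ _ _ (preserve σ u v e)
    ; reflect  = λ u v e → reflect σ u v (reflect τ _ _ e)
    }
    where import Function.Construct.Composition

  ρ : G → V → V
  ρ g (x , i) = (x ∙ g , i)

  VertexTransitive : Set
  VertexTransitive = ∀ u v → ∃ λ (σ : Aut) → app σ u ≡ v

  -- R_G ⊴ Aut(Γ): every conjugate σ⁻¹ ρ_g σ lies in R_G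
  -- (v^(σ⁻¹ ρ_g σ) = σ (ρ_g (σ⁻¹ v))).
  Normal : Set
  Normal = ∀ (σ : Aut) (g : G) → ∃ λ h → ∀ v →
             app σ (ρ g (Inverse.from (perm σ) v)) ≡ ρ h v

D8 : Set
D8 = Dih 4

D8mul : D8 → D8 → D8
D8mul = dmul 4

D16 : Set
D16 = Dih 8

D16mul : D16 → D16 → D16
D16mul = dmul 8

-- Connectedness forces G = ⟨a, b⟩, and since a and b are involutions in an abelian group,
-- G is ℤ₂ (when a = b) or ℤ₂ × ℤ₂.  In these two cases Γ is the 4-cycle, respectively the
-- 8-cycle, and an automorphism of an n-cycle is determined by the image of one edge, so
-- Aut(Γ) is the dihedral group D_{2n} acting by rotations and reflections.  The rotations
-- make Γ vertex-transitive, and conjugating ρ_a by a rotation by one step yields a map that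
-- changes the layer of a vertex, which no ρ_h does; so R_G is not normal.
module Submission where

open import Defs
open import Algebra.Bundles using (AbelianGroup)
open import Algebra.Structures using (IsAbelianGroup)
import Algebra.Properties.CommutativeSemigroup as CommutativeSemigroupProperties
import Algebra.Properties.Group as GroupProperties
open import Data.Bool using (Bool; true; false; not; _xor_)
import Data.Bool.Properties as Bool
open import Data.Empty using (⊥-elim)
open import Data.Fin using (Fin; toℕ; _≟_)
open import Data.Fin.Patterns using (0F; 1F; 2F; 3F; 4F; 5F; 6F; 7F)
open import Data.Fin.Properties using (all?)
open import Data.Nat using (ℕ; zero; suc; _+_; _∸_; NonZero)
open import Data.Nat.DivMod using (_mod_)
open import Data.Product using (_×_; _,_; ∃; proj₁; proj₂)
open import Data.Product.Properties using (≡-dec)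
open import Data.Sum using (_⊎_; inj₁; inj₂)
open import Function using (_∘_; id)
open import Function.Bundles using (_↔_; Inverse; _⇔_; Equivalence; mk↔ₛ′; mk⇔; Injection)
open import Function.Construct.Composition using (_↔-∘_; _⇔-∘_)
open import Function.Construct.Symmetry using (↔-sym)
open import Function.Definitions using (Injective)
open import Function.Properties.Inverse using (↔⇒↣)
open import Relation.Binary.Definitions using (DecidableEquality)
open import Relation.Binary.PropositionalEquality
open import Data.Unit using (tt)
open import Relation.Nullary using (Dec; yes; no; ¬_; does)
open import Relation.Nullary.Decidable
  using (True; toWitness; map′; _×-dec_; _⊎-dec_; _→-dec_; ¬?; via-injection)
open import Relation.Unary using (Decidable)

module Cycle (n : ℕ) .{{_ : NonZero n}} where

  origin : Fin n
  origin = 0 mod n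

  next : Fin n → Fin n
  next k = suc (toℕ k) mod n

  next^ : ℕ → Fin n
  next^ zero    = origin
  next^ (suc m) = next (next^ m)

  infix 4 _~_ _~?_

  _~_ : Fin n → Fin n → Set
  k ~ l = l ≡ next k ⊎ k ≡ next l

  _~?_ : (k l : Fin n) → Dec (k ~ l)
  k ~? l = l ≟ next k ⊎-dec k ≟ next l

  act : Dih n → Fin n → Fin n
  act (i , false) k = (toℕ i + toℕ k) mod n
  act (i , true)  k = (toℕ i + (n ∸ toℕ k)) mod n

  inv : Dih n → Dih n
  inv (i , false) = ((n ∸ toℕ i) mod n , false)
  inv (i , true)  = (i , true)

  -- The symmetry sending the edge origin – next origin to the edge c – d.
  through : Fin n → Fin n → Dih n
  through c d = (c , not (does (d ≟ next c)))

  -- 2q − p, the neighbour of q other than p.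
  beyond : Fin n → Fin n → Fin n
  beyond p q = (toℕ q + toℕ q + (n ∸ toℕ p)) mod n

  exchange : Fin n → Fin n → Dih n
  exchange k l = ((toℕ k + toℕ l) mod n , true)

  record Facts : Set where
    field
      through-origin : ∀ c d → c ~ d →
                       act (through c d) origin ≡ c × act (through c d) (next origin) ≡ d
      through-act    : ∀ x → through (act x origin) (act x (next origin)) ≡ x
      act-~          : ∀ x k l → k ~ l → act x k ~ act x l
      act-dmul       : ∀ x y k → act (dmul n x y) k ≡ act x (act y k)
      act-inv-act    : ∀ x k → act (inv x) (act x k) ≡ k
      act-act-inv    : ∀ x k → act x (act (inv x) k) ≡ k
      act-exchange   : ∀ k l → act (exchange k l) k ≡ l
      next-next-≢    : ∀ k → k ≢ next (next k)
      beyond-unique  : ∀ p q r → p ~ q → q ~ r → p ≢ r → r ≡ beyond p q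
      next^-toℕ      : ∀ k → next^ (toℕ k) ≡ k

  private
    all-Dih? : {P : Dih n → Set} → Decidable P → Dec (∀ x → P x)
    all-Dih? P? = map′ (λ h → λ { (i , false) → proj₁ (h i) ; (i , true) → proj₂ (h i) })
                       (λ h i → h (i , false) , h (i , true))
                       (all? λ i → P? (i , false) ×-dec P? (i , true))

    _≟ᴰ_ : DecidableEquality (Dih n)
    _≟ᴰ_ = ≡-dec _≟_ Bool._≟_

  facts? : Dec Facts
  facts? = map′
    (λ (f₁ , f₂ , f₃ , f₄ , f₅ , f₆ , f₇ , f₈ , f₉ , f₁₀) → record
      { through-origin = f₁ ; through-act = f₂ ; act-~ = f₃ ; act-dmul = f₄ ; act-inv-act = f₅
      ; act-act-inv = f₆ ; act-exchange = f₇ ; next-next-≢ = f₈ ; beyond-unique = f₉ ; next^-toℕ = f₁₀ })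
    (λ F → let open Facts F in
      through-origin , through-act , act-~ , act-dmul , act-inv-act ,
      act-act-inv , act-exchange , next-next-≢ , beyond-unique , next^-toℕ)
    (    all? (λ c → all? λ d → c ~? d →-dec
                 (act (through c d) origin ≟ c ×-dec act (through c d) (next origin) ≟ d))
    ×-dec all-Dih? (λ x → through (act x origin) (act x (next origin)) ≟ᴰ x)
    ×-dec all-Dih? (λ x → all? λ k → all? λ l → k ~? l →-dec act x k ~? act x l)
    ×-dec all-Dih? (λ x → all-Dih? λ y → all? λ k → act (dmul n x y) k ≟ act x (act y k))
    ×-dec all-Dih? (λ x → all? λ k → act (inv x) (act x k) ≟ k)
    ×-dec all-Dih? (λ x → all? λ k → act x (act (inv x) k) ≟ k)
    ×-dec all? (λ k → all? λ l → act (exchange k l) k ≟ l)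
    ×-dec all? (λ k → ¬? (k ≟ next (next k)))
    ×-dec all? (λ p → all? λ q → all? λ r →
                 p ~? q →-dec q ~? r →-dec ¬? (p ≟ r) →-dec r ≟ beyond p q)
    ×-dec all? (λ k → next^ (toℕ k) ≟ k))

  module Rigidity (F : Facts) where
    open Facts F

    act↔ : Dih n → Fin n ↔ Fin n
    act↔ x = mk↔ₛ′ (act x) (act (inv x)) (act-act-inv x) (act-inv-act x)

    act-injective : ∀ x → Injective _≡_ _≡_ (act x)
    act-injective x = Injection.injective (↔⇒↣ (act↔ x))

    continues : ∀ f → (∀ {k l} → k ~ l → f k ~ f l) → Injective _≡_ _≡_ f →
                ∀ k → f (next (next k)) ≡ beyond (f k) (f (next k))
    continues f f-~ f-inj k =
      beyond-unique _ _ _ (f-~ (inj₁ refl)) (f-~ (inj₁ refl)) (next-next-≢ k ∘ f-inj)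

    ≗-act-through : ∀ f → (∀ {k l} → k ~ l → f k ~ f l) → Injective _≡_ _≡_ f →
                    ∀ k → f k ≡ act (through (f origin) (f (next origin))) k
    ≗-act-through f f-~ f-inj k =
      subst (λ j → f j ≡ act x j) (next^-toℕ k) (proj₁ (agree (toℕ k)))
      where
      x : Dih n
      x = through (f origin) (f (next origin))

      agree : ∀ m → f (next^ m) ≡ act x (next^ m) × f (next^ (suc m)) ≡ act x (next^ (suc m))
      agree zero with through-origin _ _ (f-~ (inj₁ refl))
      ... | x-origin , x-next = sym x-origin , sym x-next
      agree (suc m) with agree m
      ... | fk , fk′ = fk′ , (begin
        f (next (next k′))                   ≡⟨ continues f f-~ f-inj k′ ⟩
        beyond (f k′) (f (next k′))          ≡⟨ cong₂ beyond fk fk′ ⟩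
        beyond (act x k′) (act x (next k′))  ≡⟨ continues (act x) (act-~ x _ _) (act-injective x) k′ ⟨
        act x (next (next k′))               ∎)
        where
        open ≡-Reasoning
        k′ : Fin n
        k′ = next^ m

IsGraphIso : {A B : Set} → (A → A → Set) → (B → B → Set) → A ↔ B → Set
IsGraphIso R S f = ∀ x y → R x y ⇔ S (Inverse.to f x) (Inverse.to f y)

module _ {A B : Set} {R : A → A → Set} {S : B → B → Set} (f : A ↔ B) where
  open Inverse f

  graphIso-from : IsGraphIso R S f → ∀ k l → R (from k) (from l) ⇔ S k l
  graphIso-from iso k l =
    subst₂ (λ k′ l′ → R (from k) (from l) ⇔ S k′ l′) (strictlyInverseˡ k) (strictlyInverseˡ l)
      (iso (from k) (from l))

  graphIso-via-from : (∀ k l → R (from k) (from l) ⇔ S k l) → IsGraphIso R S f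
  graphIso-via-from iso x y =
    subst₂ (λ x′ y′ → R x′ y′ ⇔ S (to x) (to y)) (strictlyInverseʳ x) (strictlyInverseʳ y)
      (iso (to x) (to y))

graphIso-∘ : {A B C : Set} {R : A → A → Set} {S : B → B → Set} {T : C → C → Set}
             {g : B ↔ C} {f : A ↔ B} → IsGraphIso S T g → IsGraphIso R S f →
             IsGraphIso R T (g ↔-∘ f)
graphIso-∘ g-iso f-iso x y = g-iso _ _ ⇔-∘ f-iso x y

-- Adjacency of SC(E; {eA}, {eB}, {1}) for a group E of exponent 2 written additively, where
-- y x⁻¹ = eA reads y = eA ⊕ x.
Adj⊕ : {E : Set} → (E → E → E) → E → E → E × Layer → E × Layer → Set
Adj⊕ _⊕_ eA eB (x , one) (y , one) = y ≡ eA ⊕ x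
Adj⊕ _⊕_ eA eB (x , two) (y , two) = y ≡ eB ⊕ x
Adj⊕ _⊕_ eA eB (x , one) (y , two) = x ≡ y
Adj⊕ _⊕_ eA eB (x , two) (y , one) = x ≡ y

module _ {E : Set} (_≟ₑ_ : DecidableEquality E) (_⊕_ : E → E → E) (eA eB : E) where

  Adj⊕? : ∀ w w′ → Dec (Adj⊕ _⊕_ eA eB w w′)
  Adj⊕? (x , one) (y , one) = y ≟ₑ (eA ⊕ x)
  Adj⊕? (x , two) (y , two) = y ≟ₑ (eB ⊕ x)
  Adj⊕? (x , one) (y , two) = x ≟ₑ y
  Adj⊕? (x , two) (y , one) = x ≟ₑ y

  labels-cycle? : ∀ {n} .{{_ : NonZero n}} (vertexAt : Fin n → E × Layer) →
                  Dec (∀ k l → Adj⊕ _⊕_ eA eB (vertexAt k) (vertexAt l) ⇔ Cycle._~_ n k l)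
  labels-cycle? {n} vertexAt = all? λ k → all? λ l →
    map′ (λ (to , from) → mk⇔ to from) (λ k↔l → Equivalence.to k↔l , Equivalence.from k↔l)
      ((Adj⊕? _ _ →-dec k ~? l) ×-dec (k ~? l →-dec Adj⊕? _ _))
    where open Cycle n using (_~?_)

module SC-Properties (G : Set) (_∙_ : G → G → G) (ε : G) (_⁻¹ : G → G)
                     (isAG : IsAbelianGroup _≡_ _∙_ ε _⁻¹) (a b : G) where
  open SC G _∙_ ε _⁻¹ a b
  open IsAbelianGroup isAG using (identityˡ; identityʳ; inverseʳ)
  open ≡-Reasoning

  private
    abelianGroup : AbelianGroup _ _
    abelianGroup = record { isAbelianGroup = isAG }

  open AbelianGroup abelianGroup using (group; commutativeSemigroup)
  open GroupProperties group using (//-rightDividesˡ; //-rightDividesʳ; x∙y⁻¹≈ε⇒x≈y)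
  open CommutativeSemigroupProperties commutativeSemigroup using (interchange)

  ∙⁻¹≡⇒≡∙ : ∀ {x y c} → y ∙ (x ⁻¹) ≡ c → y ≡ c ∙ x
  ∙⁻¹≡⇒≡∙ {x} {y} yx⁻¹≡c = trans (sym (//-rightDividesˡ x y)) (cong (_∙ x) yx⁻¹≡c)

  ∙≡ε⇒≡ : ∀ {x y} → y ⁻¹ ≡ y → x ∙ y ≡ ε → x ≡ y
  ∙≡ε⇒≡ {x} {y} y⁻¹≡y xy≡ε = x∙y⁻¹≈ε⇒x≈y x y (trans (cong (x ∙_) y⁻¹≡y) xy≡ε)

  pow : G → Bool → G
  pow c false = ε
  pow c true  = c

  pow-xor : ∀ {c} → c ⁻¹ ≡ c → ∀ p q → pow c (p xor q) ≡ pow c p ∙ pow c q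
  pow-xor     c⁻¹≡c false false = sym (identityˡ ε)
  pow-xor     c⁻¹≡c false true  = sym (identityˡ _)
  pow-xor     c⁻¹≡c true  false = sym (identityʳ _)
  pow-xor {c} c⁻¹≡c true  true  = sym (trans (cong (c ∙_) (sym c⁻¹≡c)) (inverseʳ c))

  pow-injective : ∀ {c} → c ≢ ε → Injective _≡_ _≡_ (pow c)
  pow-injective c≢ε {false} {false} _   = refl
  pow-injective c≢ε {false} {true}  ε≡c = ⊥-elim (c≢ε (sym ε≡c))
  pow-injective c≢ε {true}  {false} c≡ε = ⊥-elim (c≢ε c≡ε)
  pow-injective c≢ε {true}  {true}  _   = refl

  pair : Bool × Bool → G
  pair (p , q) = pow a p ∙ pow b q

  module _ (a⁻¹≡a : a ⁻¹ ≡ a) (b⁻¹≡b : b ⁻¹ ≡ b) where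

    pair-hom : ∀ e e′ → pair (z22add e e′) ≡ pair e ∙ pair e′
    pair-hom (p , q) (p′ , q′) = begin
      pow a (p xor p′) ∙ pow b (q xor q′)        ≡⟨ cong₂ _∙_ (pow-xor a⁻¹≡a p p′) (pow-xor b⁻¹≡b q q′) ⟩
      (pow a p ∙ pow a p′) ∙ (pow b q ∙ pow b q′) ≡⟨ interchange _ _ _ _ ⟩
      (pow a p ∙ pow b q) ∙ (pow a p′ ∙ pow b q′) ∎

    pair-kernel : a ≢ ε → b ≢ ε → a ≢ b → ∀ e → pair e ≡ ε → e ≡ (false , false)
    pair-kernel a≢ε b≢ε a≢b (false , false) _    = refl
    pair-kernel a≢ε b≢ε a≢b (true  , false) aε≡ε = ⊥-elim (a≢ε (trans (sym (identityʳ a)) aε≡ε))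
    pair-kernel a≢ε b≢ε a≢b (false , true)  εb≡ε = ⊥-elim (b≢ε (trans (sym (identityˡ b)) εb≡ε))
    pair-kernel a≢ε b≢ε a≢b (true  , true)  ab≡ε = ⊥-elim (a≢b (∙≡ε⇒≡ b⁻¹≡b ab≡ε))

    pair-injective : a ≢ ε → b ≢ ε → a ≢ b → Injective _≡_ _≡_ pair
    pair-injective a≢ε b≢ε a≢b {e} {e′@(p′ , q′)} pe≡pe′ =
      cong₂ _,_ (xor≡false⇒≡ (cong proj₁ e⊕e′≡0)) (xor≡false⇒≡ (cong proj₂ e⊕e′≡0))
      where
      xor≡false⇒≡ : ∀ {x y} → x xor y ≡ false → x ≡ y
      xor≡false⇒≡ {false} {false} _ = refl
      xor≡false⇒≡ {true}  {true}  _ = refl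

      e⊕e′≡0 : z22add e e′ ≡ (false , false)
      e⊕e′≡0 = pair-kernel a≢ε b≢ε a≢b _ (begin
        pair (z22add e e′)    ≡⟨ pair-hom e e′ ⟩
        pair e ∙ pair e′      ≡⟨ cong (_∙ pair e′) pe≡pe′ ⟩
        pair e′ ∙ pair e′     ≡⟨ pair-hom e′ e′ ⟨
        pair (z22add e′ e′)   ≡⟨ cong₂ (λ x y → pair (x , y)) (Bool.xor-same p′) (Bool.xor-same q′) ⟩
        ε ∙ ε                 ≡⟨ identityˡ ε ⟩
        ε                     ∎)

  -- ρ_h never changes the layer of a vertex.
  ¬Normal-if-layer-moved : ∀ σ g v →
    proj₂ (app σ (ρ g (Inverse.from (perm σ) v))) ≢ proj₂ v → ¬ Normal
  ¬Normal-if-layer-moved σ g v moved normal = moved (cong proj₂ (proj₂ (normal σ g) v))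

  module CycleLabelled {n : ℕ} .{{_ : NonZero n}} (F : Cycle.Facts n)
                       (label : V ↔ Fin n) (label-iso : IsGraphIso Adj (Cycle._~_ n) label) where
    open Cycle n
    open Facts F
    open Rigidity F
    open Inverse label using () renaming
      (to to ℓ; from to ℓ⁻¹; strictlyInverseˡ to ℓ-ℓ⁻¹; strictlyInverseʳ to ℓ⁻¹-ℓ)

    adj⇒~ : ∀ {u v} → Adj u v → ℓ u ~ ℓ v
    adj⇒~ = Equivalence.to (label-iso _ _)

    ~⇒adj : ∀ {u v} → ℓ u ~ ℓ v → Adj u v
    ~⇒adj = Equivalence.from (label-iso _ _)

    ~⇒adj-ℓ⁻¹ : ∀ {k l} → k ~ l → Adj (ℓ⁻¹ k) (ℓ⁻¹ l)
    ~⇒adj-ℓ⁻¹ = Equivalence.from (graphIso-from label label-iso _ _)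

    adj-ℓ⁻¹⇒~ : ∀ {k l} → Adj (ℓ⁻¹ k) (ℓ⁻¹ l) → k ~ l
    adj-ℓ⁻¹⇒~ = Equivalence.to (graphIso-from label label-iso _ _)

    perm⁻¹ : Aut → V → V
    perm⁻¹ σ = Inverse.from (perm σ)

    app-perm⁻¹ : ∀ σ v → app σ (perm⁻¹ σ v) ≡ v
    app-perm⁻¹ σ = Inverse.strictlyInverseˡ (perm σ)

    perm⁻¹-app : ∀ σ v → perm⁻¹ σ (app σ v) ≡ v
    perm⁻¹-app σ = Inverse.strictlyInverseʳ (perm σ)

    perm⁻¹-≗⇒≈A : ∀ σ τ → (∀ v → perm⁻¹ σ v ≡ perm⁻¹ τ v) → σ ≈A τ
    perm⁻¹-≗⇒≈A σ τ σ⁻¹≗τ⁻¹ v = begin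
      app σ v                      ≡⟨ app-perm⁻¹ τ (app σ v) ⟨
      app τ (perm⁻¹ τ (app σ v))   ≡⟨ cong (app τ) (σ⁻¹≗τ⁻¹ (app σ v)) ⟨
      app τ (perm⁻¹ σ (app σ v))   ≡⟨ cong (app τ) (perm⁻¹-app σ v) ⟩
      app τ v                      ∎

    ≈A⇒perm⁻¹-≗ : ∀ σ τ → σ ≈A τ → ∀ v → perm⁻¹ σ v ≡ perm⁻¹ τ v
    ≈A⇒perm⁻¹-≗ σ τ σ≈τ v = begin
      perm⁻¹ σ v                     ≡⟨ perm⁻¹-app τ (perm⁻¹ σ v) ⟨
      perm⁻¹ τ (app τ (perm⁻¹ σ v))  ≡⟨ cong (perm⁻¹ τ) (σ≈τ (perm⁻¹ σ v)) ⟨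
      perm⁻¹ τ (app σ (perm⁻¹ σ v))  ≡⟨ cong (perm⁻¹ τ) (app-perm⁻¹ σ v) ⟩
      perm⁻¹ τ v                     ∎

    -- σ⁻¹ read on the cycle; it is σ⁻¹ rather than σ that turns _∘A_ into dmul n.
    induced↔ : Aut → Fin n ↔ Fin n
    induced↔ σ = label ↔-∘ (↔-sym (perm σ) ↔-∘ ↔-sym label)

    induced : Aut → Fin n → Fin n
    induced σ = Inverse.to (induced↔ σ)

    induced-injective : ∀ σ → Injective _≡_ _≡_ (induced σ)
    induced-injective σ = Injection.injective (↔⇒↣ (induced↔ σ))

    induced-~ : ∀ σ {k l} → k ~ l → induced σ k ~ induced σ l
    induced-~ σ {k} {l} k~l = adj⇒~ (reflect σ _ _
      (subst₂ Adj (sym (app-perm⁻¹ σ (ℓ⁻¹ k))) (sym (app-perm⁻¹ σ (ℓ⁻¹ l))) (~⇒adj-ℓ⁻¹ k~l)))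

    induced-∘A : ∀ σ τ k → induced (σ ∘A τ) k ≡ induced σ (induced τ k)
    induced-∘A σ τ k = cong (ℓ ∘ perm⁻¹ σ) (sym (ℓ⁻¹-ℓ _))

    perm⁻¹-via-induced : ∀ σ v → perm⁻¹ σ v ≡ ℓ⁻¹ (induced σ (ℓ v))
    perm⁻¹-via-induced σ v = sym (trans (ℓ⁻¹-ℓ _) (cong (perm⁻¹ σ) (ℓ⁻¹-ℓ v)))

    toDih : Aut → Dih n
    toDih σ = through (induced σ origin) (induced σ (next origin))

    induced≗act : ∀ σ k → induced σ k ≡ act (toDih σ) k
    induced≗act σ = ≗-act-through (induced σ) (induced-~ σ) (induced-injective σ)

    toDih-unique : ∀ σ x → (∀ k → induced σ k ≡ act x k) → toDih σ ≡ x
    toDih-unique σ x σ≗x = trans (cong₂ through (σ≗x origin) (σ≗x (next origin))) (through-act x)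

    fromDih : Dih n → Aut
    fromDih x = record
      { perm     = ↔-sym label ↔-∘ (↔-sym (act↔ x) ↔-∘ label)
      ; preserve = λ u v uv → ~⇒adj-ℓ⁻¹ (act-~ (inv x) _ _ (adj⇒~ uv))
      ; reflect  = λ u v uv → ~⇒adj
          (subst₂ _~_ (act-act-inv x (ℓ u)) (act-act-inv x (ℓ v)) (act-~ x _ _ (adj-ℓ⁻¹⇒~ uv)))
      }

    induced-fromDih : ∀ x k → induced (fromDih x) k ≡ act x k
    induced-fromDih x k = trans (ℓ-ℓ⁻¹ _) (cong (act x) (ℓ-ℓ⁻¹ k))

    Aut≅Dih : GroupIso Aut _≈A_ _∘A_ (Dih n) (dmul n)
    Aut≅Dih = record
      { φ      = toDih
      ; φ-cong = λ {σ} {τ} σ≈τ →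
          cong₂ through (cong ℓ (≈A⇒perm⁻¹-≗ σ τ σ≈τ _)) (cong ℓ (≈A⇒perm⁻¹-≗ σ τ σ≈τ _))
      ; φ-hom  = λ σ τ → toDih-unique (σ ∘A τ) (dmul n (toDih σ) (toDih τ)) λ k → begin
          induced (σ ∘A τ) k                   ≡⟨ induced-∘A σ τ k ⟩
          induced σ (induced τ k)              ≡⟨ induced≗act σ _ ⟩
          act (toDih σ) (induced τ k)          ≡⟨ cong (act (toDih σ)) (induced≗act τ k) ⟩
          act (toDih σ) (act (toDih τ) k)      ≡⟨ act-dmul (toDih σ) (toDih τ) k ⟨
          act (dmul n (toDih σ) (toDih τ)) k   ∎
      ; φ-inj  = λ {σ} {τ} σ≡τ → perm⁻¹-≗⇒≈A σ τ λ v → begin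
          perm⁻¹ σ v                   ≡⟨ perm⁻¹-via-induced σ v ⟩
          ℓ⁻¹ (induced σ (ℓ v))        ≡⟨ cong ℓ⁻¹ (induced≗act σ (ℓ v)) ⟩
          ℓ⁻¹ (act (toDih σ) (ℓ v))    ≡⟨ cong (λ x → ℓ⁻¹ (act x (ℓ v))) σ≡τ ⟩
          ℓ⁻¹ (act (toDih τ) (ℓ v))    ≡⟨ cong ℓ⁻¹ (induced≗act τ (ℓ v)) ⟨
          ℓ⁻¹ (induced τ (ℓ v))        ≡⟨ perm⁻¹-via-induced τ v ⟨
          perm⁻¹ τ v                   ∎
      ; φ-surj = λ x → fromDih x , toDih-unique (fromDih x) x (induced-fromDih x)
      }

    vertexTransitive : VertexTransitive
    vertexTransitive u v =
      fromDih (exchange (ℓ u) (ℓ v)) , trans (cong ℓ⁻¹ (act-exchange (ℓ u) (ℓ v))) (ℓ⁻¹-ℓ v)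

    ¬Normal-if-conjugate-moves-layer : ∀ x g k →
      proj₂ (ℓ⁻¹ (act (inv x) (ℓ (ρ g (ℓ⁻¹ (act x k)))))) ≢ proj₂ (ℓ⁻¹ k) → ¬ Normal
    ¬Normal-if-conjugate-moves-layer x g k moved = ¬Normal-if-layer-moved (fromDih x) g (ℓ⁻¹ k)
      (subst (λ j → proj₂ (ℓ⁻¹ (act (inv x) (ℓ (ρ g (ℓ⁻¹ (act x j)))))) ≢ proj₂ (ℓ⁻¹ k))
             (sym (ℓ-ℓ⁻¹ k)) moved)

  module Generated (connected : Connected) {E : Set} (_⊕_ : E → E → E) (0ₑ eA eB : E)
                   (emb : E → G) (emb-hom : ∀ e e′ → emb (e ⊕ e′) ≡ emb e ∙ emb e′)
                   (emb-0 : emb 0ₑ ≡ ε) (emb-eA : emb eA ≡ a) (emb-eB : emb eB ≡ b)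
                   (emb-injective : Injective _≡_ _≡_ emb) where

    Image : G → Set
    Image x = ∃ λ e → emb e ≡ x

    image-∙ : ∀ {x y} → Image x → Image y → Image (x ∙ y)
    image-∙ (e , refl) (e′ , refl) = e ⊕ e′ , emb-hom e e′

    adj-image : ∀ {u v} → Adj u v → Image (proj₁ u) → Image (proj₁ v)
    adj-image (adjR yx⁻¹≡a) im = subst Image (sym (∙⁻¹≡⇒≡∙ yx⁻¹≡a)) (image-∙ (eA , emb-eA) im)
    adj-image (adjL yx⁻¹≡b) im = subst Image (sym (∙⁻¹≡⇒≡∙ yx⁻¹≡b)) (image-∙ (eB , emb-eB) im)
    adj-image (adj12 _)     im = im
    adj-image (adj21 _)     im = im

    walk-image : ∀ {u v} → Walk u v → Image (proj₁ u) → Image (proj₁ v)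
    walk-image nil         = id
    walk-image (cons uv w) = walk-image w ∘ adj-image uv

    emb-surjective : ∀ x → Image x
    emb-surjective x = walk-image (connected (ε , one) (x , one)) (0ₑ , emb-0)

    enc : G → E
    enc x = proj₁ (emb-surjective x)

    emb-enc : ∀ x → emb (enc x) ≡ x
    emb-enc x = proj₂ (emb-surjective x)

    enc-emb : ∀ e → enc (emb e) ≡ e
    enc-emb e = emb-injective (emb-enc (emb e))

    enc-injective : Injective _≡_ _≡_ enc
    enc-injective {x} {y} ex≡ey = trans (sym (emb-enc x)) (trans (cong emb ex≡ey) (emb-enc y))

    enc-hom : ∀ x y → enc (x ∙ y) ≡ enc x ⊕ enc y
    enc-hom x y = emb-injective (begin
      emb (enc (x ∙ y))             ≡⟨ emb-enc (x ∙ y) ⟩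
      x ∙ y                         ≡⟨ cong₂ _∙_ (emb-enc x) (emb-enc y) ⟨
      emb (enc x) ∙ emb (enc y)     ≡⟨ emb-hom (enc x) (enc y) ⟨
      emb (enc x ⊕ enc y)           ∎)

    enc-∙ : ∀ {c e} → emb e ≡ c → ∀ x → enc (c ∙ x) ≡ e ⊕ enc x
    enc-∙ {c} {e} ec≡c x = trans (enc-hom c x) (cong (_⊕ enc x) (trans (cong enc (sym ec≡c)) (enc-emb e)))

    G≅E : GroupIso G _≡_ _∙_ E _⊕_
    G≅E = record
      { φ      = enc
      ; φ-cong = cong enc
      ; φ-hom  = enc-hom
      ; φ-inj  = enc-injective
      ; φ-surj = λ e → emb e , enc-emb e
      }

    label : V ↔ (E × Layer)
    label = mk↔ₛ′ (λ v → enc (proj₁ v) , proj₂ v) (λ w → emb (proj₁ w) , proj₂ w)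
                  (λ w → cong (_, proj₂ w) (enc-emb (proj₁ w)))
                  (λ v → cong (_, proj₂ v) (emb-enc (proj₁ v)))

    translation-iso : ∀ {i x y c e} → emb e ≡ c →
      (y ∙ (x ⁻¹) ≡ c → Adj (x , i) (y , i)) → (Adj (x , i) (y , i) → y ∙ (x ⁻¹) ≡ c) →
      Adj (x , i) (y , i) ⇔ (enc y ≡ e ⊕ enc x)
    translation-iso {x = x} {y} {c} ec≡c intro elim = mk⇔
      (λ xy → trans (cong enc (∙⁻¹≡⇒≡∙ (elim xy))) (enc-∙ ec≡c x))
      (λ ey≡e⊕ex → intro (begin
        y ∙ (x ⁻¹)         ≡⟨ cong (_∙ (x ⁻¹)) (enc-injective (trans ey≡e⊕ex (sym (enc-∙ ec≡c x)))) ⟩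
        (c ∙ x) ∙ (x ⁻¹)   ≡⟨ //-rightDividesʳ x c ⟩
        c                  ∎))

    label-iso : IsGraphIso Adj (Adj⊕ _⊕_ eA eB) label
    label-iso (x , one) (y , one) = translation-iso emb-eA adjR λ { (adjR yx⁻¹≡a) → yx⁻¹≡a }
    label-iso (x , two) (y , two) = translation-iso emb-eB adjL λ { (adjL yx⁻¹≡b) → yx⁻¹≡b }
    label-iso (x , one) (y , two) = mk⇔ (λ { (adj12 _) → refl })
      (λ ex≡ey → subst (λ y′ → Adj (x , one) (y′ , two)) (enc-injective ex≡ey) (adj12 x))
    label-iso (x , two) (y , one) = mk⇔ (λ { (adj21 _) → refl })
      (λ ex≡ey → subst (λ y′ → Adj (x , two) (y′ , one)) (enc-injective ex≡ey) (adj21 x))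

    module Labelled {n : ℕ} .{{_ : NonZero n}} (F : Cycle.Facts n)
                    (code : (E × Layer) ↔ Fin n)
                    (code-iso : IsGraphIso (Adj⊕ _⊕_ eA eB) (Cycle._~_ n) code) where
      open Cycle n using (act; inv)
      open Inverse code using () renaming (to to c; from to c⁻¹)

      labelling : V ↔ Fin n
      labelling = code ↔-∘ label

      labelling-iso : IsGraphIso Adj (Cycle._~_ n) labelling
      labelling-iso = graphIso-∘ {S = Adj⊕ _⊕_ eA eB} {T = Cycle._~_ n} {g = code} {f = label}
                                 code-iso label-iso

      private
        module C = CycleLabelled F labelling labelling-iso
      open C public using (Aut≅Dih; vertexTransitive)

      shiftA : E × Layer → E × Layer
      shiftA (e , i) = e ⊕ eA , i

      relabel-ρa : ∀ k → Inverse.to labelling (ρ a (Inverse.from labelling k)) ≡ c (shiftA (c⁻¹ k))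
      relabel-ρa k = cong (λ e → c (e , proj₂ (c⁻¹ k)))
        (trans (enc-hom _ a) (cong₂ _⊕_ (enc-emb _) (trans (cong enc (sym emb-eA)) (enc-emb eA))))

      ¬Normal-if-ρa-conjugate-moves-layer : ∀ x k →
        proj₂ (c⁻¹ (act (inv x) (c (shiftA (c⁻¹ (act x k)))))) ≢ proj₂ (c⁻¹ k) → ¬ Normal
      ¬Normal-if-ρa-conjugate-moves-layer x k moved = C.¬Normal-if-conjugate-moves-layer x a k
        (subst (λ j → proj₂ (c⁻¹ (act (inv x) j)) ≢ proj₂ (c⁻¹ k)) (sym (relabel-ρa (act x k))) moved)

facts₄ : Cycle.Facts 4
facts₄ = toWitness {a? = Cycle.facts? 4} tt

facts₈ : Cycle.Facts 8
facts₈ = toWitness {a? = Cycle.facts? 8} tt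

cycle₄ : (Bool × Layer) ↔ Fin 4
cycle₄ = mk↔ₛ′ position vertexAt position-vertexAt vertexAt-position
  where
  vertexAt : Fin 4 → Bool × Layer
  vertexAt 0F = false , one
  vertexAt 1F = true  , one
  vertexAt 2F = true  , two
  vertexAt 3F = false , two

  position : Bool × Layer → Fin 4
  position (false , one) = 0F
  position (true  , one) = 1F
  position (true  , two) = 2F
  position (false , two) = 3F

  position-vertexAt : ∀ k → position (vertexAt k) ≡ k
  position-vertexAt 0F = refl
  position-vertexAt 1F = refl
  position-vertexAt 2F = refl
  position-vertexAt 3F = refl

  vertexAt-position : ∀ w → vertexAt (position w) ≡ w
  vertexAt-position (false , one) = refl
  vertexAt-position (true  , one) = refl
  vertexAt-position (true  , two) = refl
  vertexAt-position (false , two) = refl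

cycle₄-iso : IsGraphIso (Adj⊕ _xor_ true true) (Cycle._~_ 4) cycle₄
cycle₄-iso = graphIso-via-from cycle₄
  (toWitness {a? = labels-cycle? Bool._≟_ _xor_ true true (Inverse.from cycle₄)} tt)

cycle₈ : ((Bool × Bool) × Layer) ↔ Fin 8
cycle₈ = mk↔ₛ′ position vertexAt position-vertexAt vertexAt-position
  where
  vertexAt : Fin 8 → (Bool × Bool) × Layer
  vertexAt 0F = (false , false) , one
  vertexAt 1F = (true  , false) , one
  vertexAt 2F = (true  , false) , two
  vertexAt 3F = (true  , true)  , two
  vertexAt 4F = (true  , true)  , one
  vertexAt 5F = (false , true)  , one
  vertexAt 6F = (false , true)  , two
  vertexAt 7F = (false , false) , two

  position : (Bool × Bool) × Layer → Fin 8
  position ((false , false) , one) = 0F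
  position ((true  , false) , one) = 1F
  position ((true  , false) , two) = 2F
  position ((true  , true)  , two) = 3F
  position ((true  , true)  , one) = 4F
  position ((false , true)  , one) = 5F
  position ((false , true)  , two) = 6F
  position ((false , false) , two) = 7F

  position-vertexAt : ∀ k → position (vertexAt k) ≡ k
  position-vertexAt 0F = refl
  position-vertexAt 1F = refl
  position-vertexAt 2F = refl
  position-vertexAt 3F = refl
  position-vertexAt 4F = refl
  position-vertexAt 5F = refl
  position-vertexAt 6F = refl
  position-vertexAt 7F = refl

  vertexAt-position : ∀ w → vertexAt (position w) ≡ w
  vertexAt-position ((false , false) , one) = refl
  vertexAt-position ((true  , false) , one) = refl
  vertexAt-position ((true  , false) , two) = refl
  vertexAt-position ((true  , true)  , two) = refl
  vertexAt-position ((true  , true)  , one) = refl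
  vertexAt-position ((false , true)  , one) = refl
  vertexAt-position ((false , true)  , two) = refl
  vertexAt-position ((false , false) , two) = refl

cycle₈-iso : IsGraphIso (Adj⊕ z22add (true , false) (false , true)) (Cycle._~_ 8) cycle₈
cycle₈-iso = graphIso-via-from cycle₈
  (toWitness {a? = labels-cycle? (≡-dec Bool._≟_ Bool._≟_) z22add (true , false) (false , true)
                                 (Inverse.from cycle₈)} tt)

lemma3p3 : (G : Set) (_∙_ : G → G → G) (ε : G) (_⁻¹ : G → G)
    → IsAbelianGroup _≡_ _∙_ ε _⁻¹
    → IsFinite G
    → ∃ (λ g → g ≢ ε)
    → (a b : G)
    → (a ⁻¹) ≡ a → (b ⁻¹) ≡ b
    → a ≢ ε → b ≢ ε
    → SC.Connected G _∙_ ε _⁻¹ a b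
    → SC.VertexTransitive G _∙_ ε _⁻¹ a b
      × ¬ SC.Normal G _∙_ ε _⁻¹ a b
      × ((GroupIso G _≡_ _∙_ Z2 z2add
            × GroupIso (SC.Aut G _∙_ ε _⁻¹ a b) (SC._≈A_ G _∙_ ε _⁻¹ a b)
                (SC._∘A_ G _∙_ ε _⁻¹ a b) D8 D8mul)
         ⊎ (GroupIso G _≡_ _∙_ Z2×Z2 z22add
            × GroupIso (SC.Aut G _∙_ ε _⁻¹ a b) (SC._≈A_ G _∙_ ε _⁻¹ a b)
                (SC._∘A_ G _∙_ ε _⁻¹ a b) D16 D16mul))
-- G ≠ 1 already follows from a ≢ ε, and finiteness only serves to decide whether a = b.
lemma3p3 G _∙_ ε _⁻¹ isAG (_ , G↔Fin) _ a b a⁻¹≡a b⁻¹≡b a≢ε b≢ε connected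
  with via-injection (↔⇒↣ G↔Fin) _≟_ a b
... | yes a≡b =
  vertexTransitive , ¬Normal-if-ρa-conjugate-moves-layer (1F , false) 0F (λ ()) , inj₁ (G≅E , Aut≅Dih)
  where
  open SC-Properties G _∙_ ε _⁻¹ isAG a b
  open Generated connected _xor_ false true true (pow a) (pow-xor a⁻¹≡a) refl refl a≡b
                 (pow-injective a≢ε)
  open Labelled facts₄ cycle₄ cycle₄-iso
... | no a≢b =
  vertexTransitive , ¬Normal-if-ρa-conjugate-moves-layer (1F , false) 0F (λ ()) , inj₂ (G≅E , Aut≅Dih)
  where
  open IsAbelianGroup isAG using (identityˡ; identityʳ)
  open SC-Properties G _∙_ ε _⁻¹ isAG a b
  open Generated connected z22add (false , false) (true , false) (false , true) pair
                 (pair-hom a⁻¹≡a b⁻¹≡b) (identityˡ ε) (identityʳ a) (identityˡ b)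
                 (pair-injective a⁻¹≡a b⁻¹≡b a≢ε b≢ε a≢b)
  open Labelled facts₈ cycle₈ cycle₈-iso
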